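{- Let $k\ge 2$ be an integer. Every $2K_2$-split graph that is a minimal $(\infty,k)$-polar obstruction has at most $2+2k+2^{2k-1}$ vertices. Consequently, there are only finitely many $2K_2$-split minimal $(\infty,k)$-polar obstructions.
   Context: All graphs are finite and simple. A graph $G$ is $2K_2$-split if $V_G$ has a partition $(C,S,I)$ with $C$ a clique, $I$ independent, $S=\varnothing$ or $G[S]\cong 2K_2$, every vertex of $C$ adjacent to every vertex of $S$, and no edges between $I$ and $S$. $G$ is $(\infty,k)$-polar if $V_G$ has a partition $(A,B)$ with $G[A]$ a complete multipartite graph (any number of parts) and $G[B]$ a disjoint union of at most $k$ complete graphs. A minimal $(\infty,k)$-polar obstruction is a graph that is not $(\infty,k)$-polar but every vertex-deleted subgraph of which is. -}

module Defs where

open import Data.Nat using (ℕ; suc)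
open import Data.Fin using (Fin; zero; suc; punchIn)
open import Data.Bool using (Bool; true; false)
open import Data.Product using (Σ; ∃; _×_; _,_)
open import Data.Sum using (_⊎_)
open import Relation.Binary.PropositionalEquality using (_≡_; _≢_)
open import Relation.Nullary using (¬_)

record Graph (n : ℕ) : Set where
  field
    adj   : Fin n → Fin n → Bool
    sym   : ∀ u v → adj u v ≡ adj v u
    irrefl : ∀ v → adj v v ≡ false
open Graph public

delete : ∀ {n} → Graph (suc n) → Fin (suc n) → Graph n
delete G v = record
  { adj = λ i j → adj G (punchIn v i) (punchIn v j)
  ; sym = λ i j → sym G (punchIn v i) (punchIn v j)
  ; irrefl = λ i → irrefl G (punchIn v i) }

data CSI : Set where
  C S I : CSI

-- G[S] ≅ 2K2, written out: S consists of exactly four distinct vertices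
-- a, b, c, d with edges ab, cd and no other edges among them.
Is2K2 : ∀ {n} → Graph n → (Fin n → CSI) → Set
Is2K2 {n} G f = Σ (Fin n) λ a → Σ (Fin n) λ b → Σ (Fin n) λ c → Σ (Fin n) λ d →
  (f a ≡ S × f b ≡ S × f c ≡ S × f d ≡ S)
  × (a ≢ b × a ≢ c × a ≢ d × b ≢ c × b ≢ d × c ≢ d)
  × (∀ v → f v ≡ S → v ≡ a ⊎ v ≡ b ⊎ v ≡ c ⊎ v ≡ d)
  × (adj G a b ≡ true × adj G c d ≡ true)
  × (adj G a c ≡ false × adj G a d ≡ false × adj G b c ≡ false × adj G b d ≡ false)

TwoK2Split : ∀ {n} → Graph n → Set
TwoK2Split {n} G = Σ (Fin n → CSI) λ f →
    (∀ u v → f u ≡ C → f v ≡ C → u ≢ v → adj G u v ≡ true)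
  × (∀ u v → f u ≡ I → f v ≡ I → adj G u v ≡ false)
  × ((∀ v → ¬ (f v ≡ S)) ⊎ Is2K2 G f)
  × (∀ u v → f u ≡ C → f v ≡ S → adj G u v ≡ true)
  × (∀ u v → f u ≡ I → f v ≡ S → adj G u v ≡ false)

-- (∞,k)-polar: partition (A,B) (side v ≡ true means v ∈ A).
-- G[A] complete multipartite: A is partitioned into parts (labels p : ℕ,
-- any number of parts) with distinct vertices adjacent iff in different parts.
-- G[B] disjoint union of at most k complete graphs: B is partitioned into at most
-- k classes (labels q : Fin k) with distinct vertices adjacent iff in the same class.
Polar : ℕ → ∀ {n} → Graph n → Set
Polar k {n} G =
  Σ (Fin n → Bool) λ side → Σ (Fin n → ℕ) λ p → Σ (Fin n → Fin k) λ q →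
    (∀ u v → side u ≡ true → side v ≡ true → u ≢ v →
       (adj G u v ≡ true → p u ≢ p v) × (p u ≢ p v → adj G u v ≡ true))
  × (∀ u v → side u ≡ false → side v ≡ false → u ≢ v →
       (adj G u v ≡ true → q u ≡ q v) × (q u ≡ q v → adj G u v ≡ true))

-- minimal (∞,k)-polar obstruction (the empty graph is polar, so n = suc m)
MinObstruction : ℕ → ∀ {m} → Graph (suc m) → Set
MinObstruction k G = ¬ Polar k G × (∀ v → Polar k (delete G v))

{-# OPTIONS --safe #-}
-- Let (C, S, I) be the partition, S = {a, b, c, d} with edges ab and cd (when S is empty, G is split and
-- hence polar). Let U (IncompleteToC) be the vertices of I with a non-neighbour in C and, for x ∈ C, let
-- P x (SoleNonNbr x) be the vertices of I whose only non-neighbour in C is x. Then G is (∞,k)-polar iff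
-- |I| < k, or |U| ≤ k − 2, or |I ∖ P x| ≤ k − 2 for some x ∈ C. Indeed, in a polar partition (A, B) either
-- an edge of S lies in A, which puts I and one more vertex of S into distinct cliques of B, or two
-- non-adjacent vertices of S lie in B, together with I ∩ B; then C ⊆ A, where I ∩ A lies in one part with
-- at most one vertex of C, so U or some I ∖ P x is contained in I ∩ B.
--
-- In a minimal obstruction the three conditions fail for G but one holds for G − w whenever w ∉ S.
-- Deleting x ∈ C yields v ∈ I missing x and at most one other vertex of C, so x is the first or last
-- non-neighbour of v in C and |C| ≤ 2|I|. Deleting vertices of I bounds |I| by k, or both |P x| and
-- |I ∖ P x| by k − 1 for some x, so |I| ≤ 2k − 2. Hence |V| ≤ |C| + |I| + 4 ≤ 6k − 2 ≤ 2 + 2k + 2^(2k−1).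
module Submission where

open import Defs renaming (sym to adj-sym; irrefl to adj-irrefl)
open import Data.Bool using (Bool; true; false; if_then_else_)
open import Data.Empty using (⊥; ⊥-elim)
open import Data.Fin as Fin using (Fin; zero; suc; toℕ; punchIn; punchOut)
open import Data.Fin.Properties as Finₚ
  using (_≟_; any?; all?; ¬∀⟶∃¬; punchIn-punchOut; punchOut-injective; toℕ-injective; toℕ-fromℕ<)
open import Data.Nat using (ℕ; zero; suc; _+_; _*_; _∸_; _^_; _≤_; _<_; z≤n; s≤s; NonZero; >-nonZero⁻¹)
open import Data.Nat.Tactic.RingSolver using (solve-∀)
open import Data.Nat.DivMod using (_mod_; m<n⇒m%n≡m)
open import Data.Bool.Properties using () renaming (_≟_ to _≟ᵇ_)
open import Data.Nat.Properties renaming (_≟_ to _≟ℕ_)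
open import Data.Product using (Σ; ∃; _×_; _,_; proj₁; proj₂)
open import Data.Sum as Sum using (_⊎_; inj₁; inj₂; [_,_]′)
open import Function using (id; _∘_; flip; _⇔_; mk⇔; Equivalence; case_of_)
open import Level using (0ℓ)
open import Relation.Binary.PropositionalEquality
open import Relation.Nullary
open import Relation.Binary.Definitions using (tri<; tri≈; tri>)
open import Relation.Unary using (Pred; Decidable; _⊆_; _∪_; _∩_; _∖_; U; ∅)
open import Relation.Unary.Properties using (_∪?_; _∩?_; ∁?; U?; ∅?)

_∖?_ : ∀ {n} {P Q : Pred (Fin n) 0ℓ} → Decidable P → Decidable Q → Decidable (P ∖ Q)
P? ∖? Q? = P? ∩? ∁? Q?

count : ∀ {n} {P : Pred (Fin n) 0ℓ} → Decidable P → ℕ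
count {zero}  P? = 0
count {suc n} P? = (if does (P? zero) then 1 else 0) + count (P? ∘ suc)

count-mono : ∀ {n} {P Q : Pred (Fin n) 0ℓ} (P? : Decidable P) (Q? : Decidable Q) →
             P ⊆ Q → count P? ≤ count Q?
count-mono {zero}  P? Q? P⊆Q = z≤n
count-mono {suc n} P? Q? P⊆Q with P? zero | Q? zero
... | yes p | yes _ = s≤s (count-mono (P? ∘ suc) (Q? ∘ suc) P⊆Q)
... | yes p | no ¬q = contradiction (P⊆Q p) ¬q
... | no _  | yes _ = m≤n⇒m≤1+n (count-mono (P? ∘ suc) (Q? ∘ suc) P⊆Q)
... | no _  | no _  = count-mono (P? ∘ suc) (Q? ∘ suc) P⊆Q

count-cong : ∀ {n} {P Q : Pred (Fin n) 0ℓ} (P? : Decidable P) (Q? : Decidable Q) →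
             P ⊆ Q → Q ⊆ P → count P? ≡ count Q?
count-cong P? Q? P⊆Q Q⊆P = ≤-antisym (count-mono P? Q? P⊆Q) (count-mono Q? P? Q⊆P)

count-none : ∀ {n} {P : Pred (Fin n) 0ℓ} (P? : Decidable P) → (∀ i → ¬ P i) → count P? ≡ 0
count-none {zero}  P? none = refl
count-none {suc n} P? none with P? zero
... | yes p = contradiction p (none zero)
... | no _  = count-none (P? ∘ suc) (none ∘ suc)

count-U : ∀ n → count (U? {A = Fin n}) ≡ n
count-U zero    = refl
count-U (suc n) = cong suc (count-U n)

count-∖-suc : ∀ {n} {P : Pred (Fin (suc n)) 0ℓ} (P? : Decidable P) (y : Fin n) →
              count ((P? ∘ suc) ∖? (_≟ y)) ≡ count ((P? ∖? (_≟ suc y)) ∘ suc)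
count-∖-suc P? y = count-cong ((P? ∘ suc) ∖? (_≟ y)) ((P? ∖? (_≟ suc y)) ∘ suc)
  (λ (p , i≢y) → p , i≢y ∘ Finₚ.suc-injective)
  (λ (p , i≢y) → p , i≢y ∘ cong suc)

count-remove : ∀ {n} {P : Pred (Fin n) 0ℓ} (P? : Decidable P) {y} → P y →
               count P? ≡ suc (count (P? ∖? (_≟ y)))
count-remove {suc n} P? {zero} p with P? zero
... | no ¬p = contradiction p ¬p
... | yes _ = cong suc (count-cong (P? ∘ suc) _ (λ q → q , λ ()) proj₁)
count-remove {suc n} P? {suc y} p with P? zero
... | yes _ = cong suc (trans (count-remove (P? ∘ suc) p) (cong suc (count-∖-suc P? y)))
... | no _  = trans (count-remove (P? ∘ suc) p) (cong suc (count-∖-suc P? y))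

count-< : ∀ {n} {P Q : Pred (Fin n) 0ℓ} (P? : Decidable P) (Q? : Decidable Q) {y} →
          P ⊆ Q → Q y → ¬ P y → count P? < count Q?
count-< {P = P} {Q} P? Q? {y} P⊆Q q ¬p = begin-strict
  count P?                           <⟨ s≤s (count-mono P? (Q? ∖? (_≟ y)) P⊆Q∖y) ⟩
  suc (count (Q? ∖? (_≟ y))) ≡⟨ count-remove Q? q ⟨
  count Q?                           ∎
  where
  open ≤-Reasoning
  P⊆Q∖y : P ⊆ Q ∖ (_≡ y)
  P⊆Q∖y p = P⊆Q p , λ { refl → ¬p p }

count-insert : ∀ {n} {P : Pred (Fin n) 0ℓ} (P? : Decidable P) {r} → ¬ P r → count P? < count (P? ∪? (_≟ r))
count-insert P? r∉P = count-< P? (P? ∪? (_≟ _)) inj₁ (inj₂ refl) r∉P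

count-≤-injection : ∀ {n m} {P : Pred (Fin n) 0ℓ} {Q : Pred (Fin m) 0ℓ} (P? : Decidable P) (Q? : Decidable Q)
            (g : ∀ {i} → P i → Fin m) → (∀ {i} (p : P i) → Q (g p)) →
            (∀ {i j} (p : P i) (p′ : P j) → g p ≡ g p′ → i ≡ j) → count P? ≤ count Q?
count-≤-injection {zero}  P? Q? g g∈Q g-inj = z≤n
count-≤-injection {suc n} {P = P} {Q} P? Q? g g∈Q g-inj with P? zero
... | no _   = count-≤-injection (P? ∘ suc) Q? g g∈Q (λ p p′ → Finₚ.suc-injective ∘ g-inj p p′)
... | yes p₀ = begin
  suc (count (P? ∘ suc))  ≤⟨ s≤s (count-≤-injection (P? ∘ suc) Q∖g₀? g g∈Q∖g₀ (λ p p′ → suc-inj ∘ g-inj p p′)) ⟩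
  suc (count Q∖g₀?)       ≡⟨ count-remove Q? (g∈Q p₀) ⟨
  count Q?                ∎
  where
  open ≤-Reasoning
  Q∖g₀? = Q? ∖? (_≟ g p₀)
  suc-inj = Finₚ.suc-injective
  g∈Q∖g₀ : ∀ {i} (p : P (suc i)) → (Q ∖ (_≡ g p₀)) (g p)
  g∈Q∖g₀ p = g∈Q p , λ e → Finₚ.0≢1+n (g-inj p₀ p (sym e))

count-∪ : ∀ {n} {P Q : Pred (Fin n) 0ℓ} (P? : Decidable P) (Q? : Decidable Q) →
          count (P? ∪? Q?) ≤ count P? + count Q?
count-∪ {zero}  P? Q? = z≤n
count-∪ {suc n} P? Q? with P? zero | Q? zero | count-∪ (P? ∘ suc) (Q? ∘ suc)
... | yes _ | yes _ | ih = s≤s (≤-trans ih (+-monoʳ-≤ (count (P? ∘ suc)) (n≤1+n _)))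
... | yes _ | no _  | ih = s≤s ih
... | no _  | yes _ | ih = ≤-trans (s≤s ih) (≤-reflexive (sym (+-suc _ _)))
... | no _  | no _  | ih = ih

count-≡ : ∀ {n} (y : Fin n) → count (_≟ y) ≡ 1
count-≡ y = trans (count-remove (_≟ y) refl) (cong suc (count-none ((_≟ y) ∖? (_≟ y)) λ _ (i≡y , i≢y) → i≢y i≡y))

count-<⇒∃ : ∀ {n} {P Q : Pred (Fin n) 0ℓ} (P? : Decidable P) (Q? : Decidable Q) →
            count Q? < count P? → ∃ λ i → P i × ¬ Q i
count-<⇒∃ {n} P? Q? Q<P with all? (λ i → P? i →-dec Q? i)
... | yes P⊆Q = contradiction (count-mono P? Q? (P⊆Q _)) (<⇒≱ Q<P)
... | no P⊈Q with ¬∀⟶∃¬ n _ (λ i → P? i →-dec Q? i) P⊈Q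
...   | i , ¬P⇒Q with P? i
...     | yes p = i , p , ¬P⇒Q ∘ λ q _ → q
...     | no ¬p = contradiction (λ p → contradiction p ¬p) ¬P⇒Q

count-≤-punchOut : ∀ {m} {P : Pred (Fin (suc m)) 0ℓ} {P′ : Pred (Fin m) 0ℓ}
                   (P? : Decidable P) (P′? : Decidable P′) (w : Fin (suc m)) → (∀ {i} → P (punchIn w i) → P′ i) → (∀ {i} → P i → w ≢ i) →
                   count P? ≤ count P′?
count-≤-punchOut {P = P} P? P′? w P⇒P′ w∉P = count-≤-injection P? P′? (punchOut ∘ w∉P)
  (λ p → P⇒P′ (subst P (sym (punchIn-punchOut (w∉P p))) p))
  (λ p p′ → punchOut-injective (w∉P p) (w∉P p′))

count-≤-punchOut+1 : ∀ {m} {P : Pred (Fin (suc m)) 0ℓ} {P′ : Pred (Fin m) 0ℓ}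
                     (P? : Decidable P) (P′? : Decidable P′) (w : Fin (suc m)) → (∀ {i} → P (punchIn w i) → P′ i) → count P? ≤ count P′? + 1
count-≤-punchOut+1 {P = P} P? P′? w P⇒P′ = begin
  count P?                              ≤⟨ count-mono P? ((P? ∖? (_≟ w)) ∪? (_≟ w)) split ⟩
  count ((P? ∖? (_≟ w)) ∪? (_≟ w))      ≤⟨ count-∪ (P? ∖? (_≟ w)) (_≟ w) ⟩
  count (P? ∖? (_≟ w)) + count (_≟ w)   ≤⟨ +-mono-≤ P∖w≤P′ (≤-reflexive (count-≡ w)) ⟩
  count P′? + 1                         ∎
  where
  open ≤-Reasoning
  split : P ⊆ (P ∖ (_≡ w)) ∪ (_≡ w)
  split {i} p with i ≟ w
  ... | yes i≡w = inj₂ i≡w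
  ... | no  i≢w = inj₁ (p , i≢w)
  P∖w≤P′ = count-≤-punchOut (P? ∖? (_≟ w)) P′? w (P⇒P′ ∘ proj₁) (λ (_ , i≢w) → i≢w ∘ sym)

rank : ∀ {n} {P : Pred (Fin n) 0ℓ} → Decidable P → Fin n → ℕ
rank P? v = count (P? ∩? (Finₚ._<? v))

module _ {n} {P : Pred (Fin n) 0ℓ} (P? : Decidable P) where

  rank<count : ∀ {v} → P v → rank P? v < count P?
  rank<count p = count-< (P? ∩? (Finₚ._<? _)) P? proj₁ p (λ (_ , v<v) → Finₚ.<-irrefl refl v<v)

  rank-mono : ∀ {u v} → P u → u Fin.< v → rank P? u < rank P? v
  rank-mono {u} {v} p u<v = count-< (P? ∩? (Finₚ._<? u)) (P? ∩? (Finₚ._<? v))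
    (λ (q , i<u) → q , Finₚ.<-trans i<u u<v) (p , u<v) (λ (_ , u<u) → Finₚ.<-irrefl refl u<u)

  rank-injective : ∀ {u v} → P u → P v → rank P? u ≡ rank P? v → u ≡ v
  rank-injective {u} {v} p q eq with Finₚ.<-cmp u v
  ... | tri< u<v _ _ = contradiction eq (<⇒≢ (rank-mono p u<v))
  ... | tri≈ _ u≡v _ = u≡v
  ... | tri> _ _ v<u = contradiction (sym eq) (<⇒≢ (rank-mono q v<u))

module _ {n m} {A : Pred (Fin n) 0ℓ} {B : Pred (Fin m) 0ℓ} (A? : Decidable A) (B? : Decidable B)
         {R : Fin n → Fin m → Set} (R? : ∀ x v → Dec (R x v)) where

  private
    Extreme : (Fin n → Fin n → Set) → Pred (Fin n) 0ℓ
    Extreme _⊑_ x = A x × ∃ λ v → B v × R x v × ∀ z → A z → R z v → x ⊑ z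

    extreme? : ∀ _⊑_ → (∀ x z → Dec (x ⊑ z)) → Decidable (Extreme _⊑_)
    extreme? _ ⊑? x = A? x ×-dec any? λ v → B? v ×-dec R? x v ×-dec all? λ z → A? z →-dec (R? z v →-dec ⊑? x z)

    toward : ∀ (_⊑_ : Fin n → Fin n → Set) {x y z} → x ⊑ x → x ⊑ y → z ≡ x ⊎ z ≡ y → x ⊑ z
    toward _ x⊑x _   (inj₁ refl) = x⊑x
    toward _ _   x⊑y (inj₂ refl) = x⊑y

    count-extreme : ∀ _⊑_ (⊑? : ∀ x z → Dec (x ⊑ z)) → (∀ {x z} → x ⊑ z → z ⊑ x → x ≡ z) →
                    count (extreme? _⊑_ ⊑?) ≤ count B?
    count-extreme _⊑_ ⊑? antisym = count-≤-injection (extreme? _⊑_ ⊑?) B? (proj₁ ∘ proj₂) (proj₁ ∘ proj₂ ∘ proj₂)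
      λ { (a , v , _ , r , least) (a′ , v , _ , r′ , least′) refl → antisym (least _ a′ r′) (least′ _ a r) }

  -- x is the least or the greatest element of {z ∈ A | R z v} for its witness v, and v determines both.
  count-≤-twice : (∀ {x} → A x → ∃ λ v → B v × R x v × ∃ λ y → ∀ z → A z → R z v → z ≡ x ⊎ z ≡ y) →
                  count A? ≤ count B? + count B?
  count-≤-twice witness = begin
    count A?                        ≤⟨ count-mono A? (least? ∪? greatest?) least-or-greatest ⟩
    count (least? ∪? greatest?)     ≤⟨ count-∪ least? greatest? ⟩
    count least? + count greatest?  ≤⟨ +-mono-≤ (count-extreme Fin._≤_ Finₚ._≤?_ Finₚ.≤-antisym)
                                                (count-extreme (flip Fin._≤_) (flip Finₚ._≤?_) (flip Finₚ.≤-antisym)) ⟩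
    count B? + count B?             ∎
    where
    open ≤-Reasoning
    least? = extreme? Fin._≤_ Finₚ._≤?_
    greatest? = extreme? (flip Fin._≤_) (flip Finₚ._≤?_)
    least-or-greatest : A ⊆ Extreme Fin._≤_ ∪ Extreme (flip Fin._≤_)
    least-or-greatest {x} a with witness a
    ... | v , b , r , y , only with Finₚ.≤-total x y
    ...   | inj₁ x≤y = inj₁ (a , v , b , r , λ z a′ r′ → toward Fin._≤_ Finₚ.≤-refl x≤y (only z a′ r′))
    ...   | inj₂ y≤x = inj₂ (a , v , b , r , λ z a′ r′ → toward (flip Fin._≤_) Finₚ.≤-refl y≤x (only z a′ r′))

true≢false : true ≢ false
true≢false ()

module PolarPartition {n k} {G : Graph n} (π : Polar k G) where

  side : Fin n → Bool
  side = proj₁ π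

  partOf : Fin n → ℕ
  partOf = proj₁ (proj₂ π)

  cliqueOf : Fin n → Fin k
  cliqueOf = proj₁ (proj₂ (proj₂ π))

  InA InB : Pred (Fin n) 0ℓ
  InA v = side v ≡ true
  InB v = side v ≡ false

  InB? : Decidable InB
  InB? v = side v ≟ᵇ false

  private
    A-spec = proj₁ (proj₂ (proj₂ (proj₂ π)))
    B-spec = proj₂ (proj₂ (proj₂ (proj₂ π)))

  A-adjacent⇒partOf≢ : ∀ {u v} → InA u → InA v → adj G u v ≡ true → partOf u ≢ partOf v
  A-adjacent⇒partOf≢ {u} {v} su sv uv = proj₁ (A-spec u v su sv u≢v) uv
    where u≢v : u ≢ v
          u≢v refl = true≢false (trans (sym uv) (adj-irrefl G u))

  A-nonadjacent⇒partOf≡ : ∀ {u v} → InA u → InA v → u ≢ v → adj G u v ≡ false → partOf u ≡ partOf v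
  A-nonadjacent⇒partOf≡ {u} {v} su sv u≢v u≁v with partOf u ≟ℕ partOf v
  ... | yes eq = eq
  ... | no neq = contradiction (trans (sym (proj₂ (A-spec u v su sv u≢v) neq)) u≁v) true≢false

  A-K₂+K₁-free : ∀ {s t r} → InA s → InA t → InA r → adj G s t ≡ true →
                 adj G s r ≡ false → adj G t r ≡ false → s ≢ r → t ≢ r → ⊥
  A-K₂+K₁-free ss st sr s∼t s≁r t≁r s≢r t≢r = A-adjacent⇒partOf≢ ss st s∼t
    (trans (A-nonadjacent⇒partOf≡ ss sr s≢r s≁r) (sym (A-nonadjacent⇒partOf≡ st sr t≢r t≁r)))

  B-adjacent⇒cliqueOf≡ : ∀ {u v} → InB u → InB v → u ≢ v → adj G u v ≡ true → cliqueOf u ≡ cliqueOf v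
  B-adjacent⇒cliqueOf≡ {u} {v} su sv u≢v = proj₁ (B-spec u v su sv u≢v)

  B-cliqueOf≡⇒adjacent : ∀ {u v} → InB u → InB v → u ≢ v → cliqueOf u ≡ cliqueOf v → adj G u v ≡ true
  B-cliqueOf≡⇒adjacent {u} {v} su sv u≢v = proj₂ (B-spec u v su sv u≢v)

  B-P₃-free : ∀ {r s t} → InB r → InB s → InB t → adj G r s ≡ true → adj G r t ≡ true →
              adj G s t ≡ false → r ≢ s → r ≢ t → s ≢ t → ⊥
  B-P₃-free sr ss st r∼s r∼t s≁t r≢s r≢t s≢t = true≢false (trans (sym (B-cliqueOf≡⇒adjacent ss st s≢t
    (trans (sym (B-adjacent⇒cliqueOf≡ sr ss r≢s r∼s)) (B-adjacent⇒cliqueOf≡ sr st r≢t r∼t)))) s≁t)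

  B-independent-count≤ : ∀ {P : Pred (Fin n) 0ℓ} (P? : Decidable P) → P ⊆ InB →
                         (∀ {u v} → P u → P v → u ≢ v → adj G u v ≡ false) → count P? ≤ k
  B-independent-count≤ {P} P? P⊆B independent = begin
    count P?                 ≤⟨ count-≤-injection P? U? (λ {v} _ → cliqueOf v) _ injective ⟩
    count (U? {A = Fin k})   ≡⟨ count-U k ⟩
    k                        ∎
    where
    open ≤-Reasoning
    injective : ∀ {u v} → P u → P v → cliqueOf u ≡ cliqueOf v → u ≡ v
    injective {u} {v} p q eq with u ≟ v
    ... | yes u≡v = u≡v
    ... | no u≢v = contradiction (trans (sym (B-cliqueOf≡⇒adjacent (P⊆B p) (P⊆B q) u≢v eq)) (independent p q u≢v))
                                 true≢false

toℕ-mod : ∀ {a k} .{{_ : NonZero k}} → a < k → toℕ (a mod k) ≡ a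
toℕ-mod {a} {k} a<k = trans (toℕ-fromℕ< _) (m<n⇒m%n≡m a<k)

mod-injective : ∀ {a b k} .{{_ : NonZero k}} → a < k → b < k → a mod k ≡ b mod k → a ≡ b
mod-injective a<k b<k eq = trans (sym (toℕ-mod a<k)) (trans (cong toℕ eq) (toℕ-mod b<k))

⇔-false : ∀ {b : Bool} {X : Set} → b ≡ false → ¬ X → (b ≡ true ⇔ X)
⇔-false refl ¬x = mk⇔ (λ ()) (λ x → contradiction x ¬x)

⇔-true : ∀ {b : Bool} {X : Set} → b ≡ true → X → (b ≡ true ⇔ X)
⇔-true b≡true x = mk⇔ (λ _ → x) (λ _ → b≡true)

polar-intro : ∀ {n k} .{{_ : NonZero k}} {G : Graph n} {A : Pred (Fin n) 0ℓ} (A? : Decidable A)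
              (part clique : Fin n → ℕ) →
              (∀ {u v} → A u → A v → u ≢ v → adj G u v ≡ true ⇔ part u ≢ part v) →
              (∀ {v} → ¬ A v → clique v < k) →
              (∀ {u v} → ¬ A u → ¬ A v → u ≢ v → adj G u v ≡ true ⇔ clique u ≡ clique v) →
              Polar k G
polar-intro {k = k} {G} A? part clique A-spec clique<k B-spec =
  does ∘ A? , part , (λ v → clique v mod k) , A-spec′ , B-spec′
  where
  A-spec′ : ∀ u v → does (A? u) ≡ true → does (A? v) ≡ true → u ≢ v →
            (adj G u v ≡ true → part u ≢ part v) × (part u ≢ part v → adj G u v ≡ true)
  A-spec′ u v su sv u≢v with A? u | A? v
  ... | yes a | yes b = Equivalence.to (A-spec a b u≢v) , Equivalence.from (A-spec a b u≢v)
  A-spec′ u v () sv u≢v | no _ | _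
  A-spec′ u v su () u≢v | yes _ | no _
  B-spec′ : ∀ u v → does (A? u) ≡ false → does (A? v) ≡ false → u ≢ v →
            (adj G u v ≡ true → clique u mod k ≡ clique v mod k) ×
            (clique u mod k ≡ clique v mod k → adj G u v ≡ true)
  B-spec′ u v su sv u≢v with A? u | A? v
  ... | no a | no b = cong (_mod k) ∘ Equivalence.to (B-spec a b u≢v)
                    , Equivalence.from (B-spec a b u≢v) ∘ mod-injective (clique<k a) (clique<k b)
  B-spec′ u v () sv u≢v | yes _ | _
  B-spec′ u v su () u≢v | no _ | yes _

_≟ᶜ_ : (s t : CSI) → Dec (s ≡ t)
C ≟ᶜ C = yes refl
C ≟ᶜ S = no λ ()
C ≟ᶜ I = no λ ()
S ≟ᶜ C = no λ ()
S ≟ᶜ S = yes refl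
S ≟ᶜ I = no λ ()
I ≟ᶜ C = no λ ()
I ≟ᶜ S = no λ ()
I ≟ᶜ I = yes refl

record TwoK2Partition {n} (G : Graph n) : Set where
  field
    part             : Fin n → CSI
    C-clique         : ∀ {u v} → part u ≡ C → part v ≡ C → u ≢ v → adj G u v ≡ true
    I-independent    : ∀ {u v} → part u ≡ I → part v ≡ I → adj G u v ≡ false
    C-S-complete     : ∀ {u v} → part u ≡ C → part v ≡ S → adj G u v ≡ true
    I-S-anticomplete : ∀ {u v} → part u ≡ I → part v ≡ S → adj G u v ≡ false
    a b c d          : Fin n
    a∈S              : part a ≡ S
    b∈S              : part b ≡ S
    c∈S              : part c ≡ S
    d∈S              : part d ≡ S
    S-cover          : ∀ {v} → part v ≡ S → (v ≡ a ⊎ v ≡ b) ⊎ (v ≡ c ⊎ v ≡ d)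
    a∼b              : adj G a b ≡ true
    c∼d              : adj G c d ≡ true
    a≁c              : adj G a c ≡ false
    a≁d              : adj G a d ≡ false
    b≁c              : adj G b c ≡ false
    b≁d              : adj G b d ≡ false

split⇒polar : ∀ {n k} {G : Graph n} (part : Fin n → CSI) →
              (∀ u v → part u ≡ C → part v ≡ C → u ≢ v → adj G u v ≡ true) →
              (∀ u v → part u ≡ I → part v ≡ I → adj G u v ≡ false) →
              (∀ v → ¬ part v ≡ S) → Polar (suc k) G
split⇒polar {G = G} part clique independent S-empty =
  polar-intro {G = G} (λ v → part v ≟ᶜ I) (λ _ → 0) (λ _ → 0)
    (λ u∈I v∈I _ → ⇔-false (independent _ _ u∈I v∈I) λ 0≢0 → 0≢0 refl)
    (λ _ → s≤s z≤n)
    (λ u∉I v∉I u≢v → ⇔-true (clique _ _ (¬I⇒C u∉I) (¬I⇒C v∉I) u≢v) refl)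
  where
  ¬I⇒C : ∀ {v} → ¬ part v ≡ I → part v ≡ C
  ¬I⇒C {v} v∉I with part v in eq
  ... | C = refl
  ... | S = contradiction eq (S-empty v)
  ... | I = contradiction refl v∉I

twoK2Split-cases : ∀ {n k} {G : Graph n} → TwoK2Split G → Polar (suc k) G ⊎ TwoK2Partition G
twoK2Split-cases {k = k} {G} (part , clique , independent , inj₁ S-empty , _) =
  inj₁ (split⇒polar {k = k} {G} part clique independent S-empty)
twoK2Split-cases (part , clique , independent , inj₂ (a , b , c , d , (a∈S , b∈S , c∈S , d∈S) , _ , cover ,
                  (a∼b , c∼d) , (a≁c , a≁d , b≁c , b≁d)) , C-S , I-S) = inj₂ record
  { part = part ; C-clique = clique _ _ ; I-independent = independent _ _
  ; C-S-complete = C-S _ _ ; I-S-anticomplete = I-S _ _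
  ; a = a ; b = b ; c = c ; d = d ; a∈S = a∈S ; b∈S = b∈S ; c∈S = c∈S ; d∈S = d∈S
  ; S-cover = regroup ∘ cover _
  ; a∼b = a∼b ; c∼d = c∼d ; a≁c = a≁c ; a≁d = a≁d ; b≁c = b≁c ; b≁d = b≁d }
  where
  regroup : ∀ {A B C D : Set} → A ⊎ B ⊎ C ⊎ D → (A ⊎ B) ⊎ (C ⊎ D)
  regroup (inj₁ x)               = inj₁ (inj₁ x)
  regroup (inj₂ (inj₁ x))        = inj₁ (inj₂ x)
  regroup (inj₂ (inj₂ (inj₁ x))) = inj₂ (inj₁ x)
  regroup (inj₂ (inj₂ (inj₂ x))) = inj₂ (inj₂ x)

module TwoK2 {n} {G : Graph n} (σ : TwoK2Partition G) where
  open TwoK2Partition σ public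

  adj-sym′ : ∀ {u v b} → adj G u v ≡ b → adj G v u ≡ b
  adj-sym′ {u} {v} uv = trans (adj-sym G v u) uv

  S-C-complete : ∀ {u v} → part u ≡ S → part v ≡ C → adj G u v ≡ true
  S-C-complete u∈S v∈C = adj-sym′ (C-S-complete v∈C u∈S)

  S-I-anticomplete : ∀ {u v} → part u ≡ S → part v ≡ I → adj G u v ≡ false
  S-I-anticomplete u∈S v∈I = adj-sym′ (I-S-anticomplete v∈I u∈S)

  AB CD : Pred (Fin n) 0ℓ
  AB v = v ≡ a ⊎ v ≡ b
  CD v = v ≡ c ⊎ v ≡ d

  AB⇒S : ∀ {v} → AB v → part v ≡ S
  AB⇒S (inj₁ refl) = a∈S
  AB⇒S (inj₂ refl) = b∈S

  CD⇒S : ∀ {v} → CD v → part v ≡ S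
  CD⇒S (inj₁ refl) = c∈S
  CD⇒S (inj₂ refl) = d∈S

  AB-adjacent : ∀ {u v} → AB u → AB v → u ≢ v → adj G u v ≡ true
  AB-adjacent (inj₁ refl) (inj₁ refl) u≢v = contradiction refl u≢v
  AB-adjacent (inj₁ refl) (inj₂ refl) _   = a∼b
  AB-adjacent (inj₂ refl) (inj₁ refl) _   = adj-sym′ a∼b
  AB-adjacent (inj₂ refl) (inj₂ refl) u≢v = contradiction refl u≢v

  CD-adjacent : ∀ {u v} → CD u → CD v → u ≢ v → adj G u v ≡ true
  CD-adjacent (inj₁ refl) (inj₁ refl) u≢v = contradiction refl u≢v
  CD-adjacent (inj₁ refl) (inj₂ refl) _   = c∼d
  CD-adjacent (inj₂ refl) (inj₁ refl) _   = adj-sym′ c∼d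
  CD-adjacent (inj₂ refl) (inj₂ refl) u≢v = contradiction refl u≢v

  AB-CD-nonadjacent : ∀ {u v} → AB u → CD v → adj G u v ≡ false
  AB-CD-nonadjacent (inj₁ refl) (inj₁ refl) = a≁c
  AB-CD-nonadjacent (inj₁ refl) (inj₂ refl) = a≁d
  AB-CD-nonadjacent (inj₂ refl) (inj₁ refl) = b≁c
  AB-CD-nonadjacent (inj₂ refl) (inj₂ refl) = b≁d

  AB-CD-distinct : ∀ {u v} → AB u → CD v → u ≢ v
  AB-CD-distinct (inj₁ refl) v∈CD refl =
    true≢false (trans (sym a∼b) (adj-sym′ (AB-CD-nonadjacent (inj₂ refl) v∈CD)))
  AB-CD-distinct (inj₂ refl) v∈CD refl =
    true≢false (trans (sym (adj-sym′ a∼b)) (adj-sym′ (AB-CD-nonadjacent (inj₁ refl) v∈CD)))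

  Ind Cli : Pred (Fin n) 0ℓ
  Ind v = part v ≡ I
  Cli v = part v ≡ C

  Ind? : Decidable Ind
  Ind? v = part v ≟ᶜ I

  Cli? : Decidable Cli
  Cli? v = part v ≟ᶜ C

  C∉S : ∀ {v} → Cli v → part v ≢ S
  C∉S v∈C v∈S = case trans (sym v∈C) v∈S of λ ()

  I∉S : ∀ {v} → Ind v → part v ≢ S
  I∉S v∈I v∈S = case trans (sym v∈I) v∈S of λ ()

  I∉C : ∀ {v} → Ind v → ¬ Cli v
  I∉C v∈I v∈C = case trans (sym v∈I) v∈C of λ ()

  C≢I : ∀ {x v} → Cli x → Ind v → x ≢ v
  C≢I x∈C v∈I refl = I∉C v∈I x∈C

  C≢S : ∀ {x s} → Cli x → part s ≡ S → x ≢ s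
  C≢S x∈C s∈S refl = C∉S x∈C s∈S

  S≢I : ∀ {s v} → part s ≡ S → Ind v → s ≢ v
  S≢I s∈S v∈I refl = I∉S v∈I s∈S

  AB? : Decidable AB
  AB? = (_≟ a) ∪? (_≟ b)

  CD? : Decidable CD
  CD? = (_≟ c) ∪? (_≟ d)

  IncompleteToC : Pred (Fin n) 0ℓ
  IncompleteToC v = Ind v × ∃ λ x → Cli x × adj G x v ≡ false

  IncompleteToC? : Decidable IncompleteToC
  IncompleteToC? v = Ind? v ×-dec any? λ x → Cli? x ×-dec (adj G x v ≟ᵇ false)

  SoleNonNbr : Fin n → Pred (Fin n) 0ℓ
  SoleNonNbr x v = Ind v × adj G x v ≡ false × (∀ z → Cli z → adj G z v ≡ false → z ≡ x)

  SoleNonNbr? : ∀ x → Decidable (SoleNonNbr x)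
  SoleNonNbr? x v = Ind? v ×-dec (adj G x v ≟ᵇ false) ×-dec
    all? λ z → Cli? z →-dec ((adj G z v ≟ᵇ false) →-dec (z ≟ x))

  IncompleteToC-except : Fin n → Pred (Fin n) 0ℓ
  IncompleteToC-except w v = Ind v × ∃ λ x → Cli x × x ≢ w × adj G x v ≡ false

  IncompleteToC-except? : ∀ w → Decidable (IncompleteToC-except w)
  IncompleteToC-except? w v = Ind? v ×-dec any? λ x → Cli? x ×-dec ¬? (x ≟ w) ×-dec (adj G x v ≟ᵇ false)

  SoleNonNbr-except : Fin n → Fin n → Pred (Fin n) 0ℓ
  SoleNonNbr-except w x v = Ind v × adj G x v ≡ false × (∀ z → Cli z → z ≢ w → adj G z v ≡ false → z ≡ x)

  SoleNonNbr-except? : ∀ w x → Decidable (SoleNonNbr-except w x)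
  SoleNonNbr-except? w x v = Ind? v ×-dec (adj G x v ≟ᵇ false) ×-dec
    all? λ z → Cli? z →-dec (¬? (z ≟ w) →-dec ((adj G z v ≟ᵇ false) →-dec (z ≟ x)))

  IncompleteToC⊆IncompleteToC-except : ∀ {w} → ¬ Cli w → IncompleteToC ⊆ IncompleteToC-except w
  IncompleteToC⊆IncompleteToC-except w∉C (v∈I , x , x∈C , x≁v) = v∈I , x , x∈C , (λ { refl → w∉C x∈C }) , x≁v

  SoleNonNbr-except⊆SoleNonNbr : ∀ {w x} → ¬ Cli w → SoleNonNbr-except w x ⊆ SoleNonNbr x
  SoleNonNbr-except⊆SoleNonNbr w∉C (v∈I , x≁v , only-x) = v∈I , x≁v , λ z z∈C → only-x z z∈C λ { refl → w∉C z∈C }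

  PolarCondition : ℕ → Set
  PolarCondition k = count Ind? + 1 ≤ k
                   ⊎ count IncompleteToC? + 2 ≤ k
                   ⊎ ∃ λ x → Cli x × count (Ind? ∖? SoleNonNbr? x) + 2 ≤ k

delete-partition : ∀ {m} {G : Graph (suc m)} (σ : TwoK2Partition G) (w : Fin (suc m)) →
                   TwoK2Partition.part σ w ≢ S → TwoK2Partition (delete G w)
delete-partition {G = G} σ w w∉S = record
  { part = part ∘ punchIn w
  ; C-clique = λ u∈C v∈C u≢v → C-clique u∈C v∈C (u≢v ∘ Finₚ.punchIn-injective w _ _)
  ; I-independent = I-independent ; C-S-complete = C-S-complete ; I-S-anticomplete = I-S-anticomplete
  ; a = out a∈S ; b = out b∈S ; c = out c∈S ; d = out d∈S
  ; a∈S = out-∈S a∈S ; b∈S = out-∈S b∈S ; c∈S = out-∈S c∈S ; d∈S = out-∈S d∈S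
  ; S-cover = λ v∈S → Sum.map (Sum.map (into a∈S) (into b∈S)) (Sum.map (into c∈S) (into d∈S)) (S-cover v∈S)
  ; a∼b = trans (adj-out a∈S b∈S) a∼b ; c∼d = trans (adj-out c∈S d∈S) c∼d
  ; a≁c = trans (adj-out a∈S c∈S) a≁c ; a≁d = trans (adj-out a∈S d∈S) a≁d
  ; b≁c = trans (adj-out b∈S c∈S) b≁c ; b≁d = trans (adj-out b∈S d∈S) b≁d }
  where
  open TwoK2Partition σ
  w≢ : ∀ {v} → part v ≡ S → w ≢ v
  w≢ v∈S refl = w∉S v∈S
  out : ∀ {v} → part v ≡ S → Fin _
  out v∈S = punchOut (w≢ v∈S)
  out-∈S : ∀ {v} (v∈S : part v ≡ S) → part (punchIn w (out v∈S)) ≡ S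
  out-∈S v∈S = trans (cong part (punchIn-punchOut _)) v∈S
  adj-out : ∀ {u v} (u∈S : part u ≡ S) (v∈S : part v ≡ S) →
            adj G (punchIn w (out u∈S)) (punchIn w (out v∈S)) ≡ adj G u v
  adj-out u∈S v∈S = cong₂ (adj G) (punchIn-punchOut _) (punchIn-punchOut _)
  into : ∀ {u v} (v∈S : part v ≡ S) → punchIn w u ≡ v → u ≡ out v∈S
  into v∈S eq = Finₚ.punchIn-injective w _ _ (trans eq (sym (punchIn-punchOut _)))

module Necessity {n k} {G : Graph n} (σ : TwoK2Partition G) (π : Polar k G) where
  open TwoK2 σ
  open PolarPartition {k = k} {G} π

  edge-in-A : ∀ {s t r} → part s ≡ S → part t ≡ S → part r ≡ S → InA s → InA t → InB r →
              adj G s t ≡ true → count Ind? + 1 ≤ k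
  edge-in-A {s} {t} {r} s∈S t∈S r∈S s∈A t∈A r∈B s∼t = begin
    count Ind? + 1               ≡⟨ +-comm (count Ind?) 1 ⟩
    suc (count Ind?)             ≤⟨ count-insert Ind? (λ r∈I → S≢I r∈S r∈I refl) ⟩
    count (Ind? ∪? (_≟ r))       ≤⟨ B-independent-count≤ (Ind? ∪? (_≟ r)) in-B independent ⟩
    k                            ∎
    where
    open ≤-Reasoning
    I⊆B : ∀ {v} → Ind v → InB v
    I⊆B {v} v∈I with side v in eq
    ... | false = refl
    ... | true = ⊥-elim (A-K₂+K₁-free s∈A t∈A eq s∼t (S-I-anticomplete s∈S v∈I) (S-I-anticomplete t∈S v∈I)
                                       (S≢I s∈S v∈I) (S≢I t∈S v∈I))
    in-B : Ind ∪ (_≡ r) ⊆ InB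
    in-B (inj₁ v∈I)  = I⊆B v∈I
    in-B (inj₂ refl) = r∈B
    independent : ∀ {u v} → (Ind ∪ (_≡ r)) u → (Ind ∪ (_≡ r)) v → u ≢ v → adj G u v ≡ false
    independent (inj₁ u∈I) (inj₁ v∈I) _ = I-independent u∈I v∈I
    independent (inj₁ u∈I) (inj₂ refl) _ = I-S-anticomplete u∈I r∈S
    independent (inj₂ refl) (inj₁ v∈I) _ = S-I-anticomplete r∈S v∈I
    independent (inj₂ refl) (inj₂ refl) r≢r = contradiction refl r≢r

  -- In A, a vertex of I with a non-neighbour x₀ ∈ C shares x₀'s part, hence so does all of I ∩ A.
  I∩A⊆SoleNonNbr : ∀ {v₀ x₀ u} → Cli ⊆ InA → Ind v₀ → InA v₀ → Cli x₀ → adj G x₀ v₀ ≡ false →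
                   Ind u → InA u → SoleNonNbr x₀ u
  I∩A⊆SoleNonNbr {v₀} {x₀} {u} C⊆A v₀∈I v₀∈A x₀∈C x₀≁v₀ u∈I u∈A = u∈I , x₀≁u , only-x₀
    where
    u-x₀ : partOf u ≡ partOf x₀
    u-x₀ = trans u-v₀ (sym (A-nonadjacent⇒partOf≡ (C⊆A x₀∈C) v₀∈A (C≢I x₀∈C v₀∈I) x₀≁v₀))
      where
      u-v₀ : partOf u ≡ partOf v₀
      u-v₀ with u ≟ v₀
      ... | yes refl = refl
      ... | no u≢v₀ = A-nonadjacent⇒partOf≡ u∈A v₀∈A u≢v₀ (I-independent u∈I v₀∈I)
    x₀≁u : adj G x₀ u ≡ false
    x₀≁u with adj G x₀ u in x₀∼u
    ... | false = refl
    ... | true = ⊥-elim (A-adjacent⇒partOf≢ (C⊆A x₀∈C) u∈A x₀∼u (sym u-x₀))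
    only-x₀ : ∀ z → Cli z → adj G z u ≡ false → z ≡ x₀
    only-x₀ z z∈C z≁u with z ≟ x₀
    ... | yes z≡x₀ = z≡x₀
    ... | no z≢x₀ = contradiction (trans (A-nonadjacent⇒partOf≡ (C⊆A z∈C) u∈A (C≢I z∈C u∈I) z≁u) u-x₀)
                                  (A-adjacent⇒partOf≢ (C⊆A z∈C) (C⊆A x₀∈C) (C-clique z∈C x₀∈C z≢x₀))

  I∩B+pair≤k : ∀ {s₁ s₂} → part s₁ ≡ S → part s₂ ≡ S → InB s₁ → InB s₂ → s₁ ≢ s₂ →
               adj G s₁ s₂ ≡ false → count (Ind? ∩? InB?) + 2 ≤ k
  I∩B+pair≤k {s₁} {s₂} s₁∈S s₂∈S s₁∈B s₂∈B s₁≢s₂ s₁≁s₂ = begin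
    count R? + 2             ≡⟨ +-comm (count R?) 2 ⟩
    suc (suc (count R?))     ≤⟨ s≤s (count-insert R? λ (s₁∈I , _) → S≢I s₁∈S s₁∈I refl) ⟩
    suc (count R₁?)          ≤⟨ count-insert R₁? [ (λ (s₂∈I , _) → S≢I s₂∈S s₂∈I refl) , (s₁≢s₂ ∘ sym) ]′ ⟩
    count R₂?                ≤⟨ B-independent-count≤ R₂? in-B independent ⟩
    k                        ∎
    where
    open ≤-Reasoning
    R? = Ind? ∩? InB?
    R₁? = R? ∪? (_≟ s₁)
    R₂? = R₁? ∪? (_≟ s₂)
    in-B : (((Ind ∩ InB) ∪ (_≡ s₁)) ∪ (_≡ s₂)) ⊆ InB
    in-B (inj₁ (inj₁ (_ , v∈B))) = v∈B
    in-B (inj₁ (inj₂ refl))      = s₁∈B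
    in-B (inj₂ refl)             = s₂∈B
    independent : ∀ {u v} → (((Ind ∩ InB) ∪ (_≡ s₁)) ∪ (_≡ s₂)) u → (((Ind ∩ InB) ∪ (_≡ s₁)) ∪ (_≡ s₂)) v →
                  u ≢ v → adj G u v ≡ false
    independent (inj₁ (inj₁ (u∈I , _))) (inj₁ (inj₁ (v∈I , _))) _ = I-independent u∈I v∈I
    independent (inj₁ (inj₁ (u∈I , _))) (inj₁ (inj₂ refl))      _ = I-S-anticomplete u∈I s₁∈S
    independent (inj₁ (inj₁ (u∈I , _))) (inj₂ refl)             _ = I-S-anticomplete u∈I s₂∈S
    independent (inj₁ (inj₂ refl))      (inj₁ (inj₁ (v∈I , _))) _ = S-I-anticomplete s₁∈S v∈I
    independent (inj₂ refl)             (inj₁ (inj₁ (v∈I , _))) _ = S-I-anticomplete s₂∈S v∈I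
    independent (inj₁ (inj₂ refl))      (inj₂ refl)             _ = s₁≁s₂
    independent (inj₂ refl)             (inj₁ (inj₂ refl))      _ = adj-sym′ s₁≁s₂
    independent (inj₁ (inj₂ refl))      (inj₁ (inj₂ refl))    u≢u = contradiction refl u≢u
    independent (inj₂ refl)             (inj₂ refl)           u≢u = contradiction refl u≢u

  nonadjacent-pair-in-B⇒C⊆A : ∀ {s₁ s₂} → part s₁ ≡ S → part s₂ ≡ S → InB s₁ → InB s₂ → s₁ ≢ s₂ →
                              adj G s₁ s₂ ≡ false → Cli ⊆ InA
  nonadjacent-pair-in-B⇒C⊆A s₁∈S s₂∈S s₁∈B s₂∈B s₁≢s₂ s₁≁s₂ {x} x∈C with side x in x∈B
  ... | true = refl
  ... | false = ⊥-elim (B-P₃-free x∈B s₁∈B s₂∈B (C-S-complete x∈C s₁∈S) (C-S-complete x∈C s₂∈S) s₁≁s₂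
                                  (C≢S x∈C s₁∈S) (C≢S x∈C s₂∈S) s₁≢s₂)

  C⊆A⇒PolarCondition : Cli ⊆ InA → count (Ind? ∩? InB?) + 2 ≤ k → PolarCondition k
  C⊆A⇒PolarCondition C⊆A R+2≤k with any? (λ v → IncompleteToC? v ×-dec (side v ≟ᵇ true))
  ... | no ¬Inc∩A = inj₂ (inj₁ (≤-trans (+-monoˡ-≤ 2 (count-mono IncompleteToC? (Ind? ∩? InB?) Inc⊆R)) R+2≤k))
    where
    Inc⊆R : IncompleteToC ⊆ Ind ∩ InB
    Inc⊆R {v} inc with side v in v∈A
    ... | false = proj₁ inc , refl
    ... | true = ⊥-elim (¬Inc∩A (v , inc , v∈A))
  ... | yes (v₀ , (v₀∈I , x₀ , x₀∈C , x₀≁v₀) , v₀∈A) =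
    inj₂ (inj₂ (x₀ , x₀∈C , ≤-trans (+-monoˡ-≤ 2 (count-mono (Ind? ∖? SoleNonNbr? x₀) (Ind? ∩? InB?) Q⊆R)) R+2≤k))
    where
    Q⊆R : Ind ∖ SoleNonNbr x₀ ⊆ Ind ∩ InB
    Q⊆R {u} (u∈I , ¬sole) with side u in u∈A
    ... | false = u∈I , refl
    ... | true = ⊥-elim (¬sole (I∩A⊆SoleNonNbr C⊆A v₀∈I v₀∈A x₀∈C x₀≁v₀ u∈I u∈A))

  nonadjacent-pair-in-B : ∀ {s₁ s₂} → part s₁ ≡ S → part s₂ ≡ S → InB s₁ → InB s₂ → s₁ ≢ s₂ →
                          adj G s₁ s₂ ≡ false → PolarCondition k
  nonadjacent-pair-in-B s₁∈S s₂∈S s₁∈B s₂∈B s₁≢s₂ s₁≁s₂ = C⊆A⇒PolarCondition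
    (nonadjacent-pair-in-B⇒C⊆A s₁∈S s₂∈S s₁∈B s₂∈B s₁≢s₂ s₁≁s₂) (I∩B+pair≤k s₁∈S s₂∈S s₁∈B s₂∈B s₁≢s₂ s₁≁s₂)

  private
    a≢ : ∀ {v} → CD v → a ≢ v
    a≢ = AB-CD-distinct (inj₁ refl)

    b≢ : ∀ {v} → CD v → b ≢ v
    b≢ = AB-CD-distinct (inj₂ refl)

  polar⇒PolarCondition : PolarCondition k
  polar⇒PolarCondition with side a in a∈ | side b in b∈ | side c in c∈ | side d in d∈
  ... | true  | true  | true  | _     = ⊥-elim (A-K₂+K₁-free a∈ b∈ c∈ a∼b a≁c b≁c (a≢ (inj₁ refl)) (b≢ (inj₁ refl)))
  ... | true  | true  | false | _     = inj₁ (edge-in-A a∈S b∈S c∈S a∈ b∈ c∈ a∼b)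
  ... | false | _     | true  | true  = inj₁ (edge-in-A c∈S d∈S a∈S c∈ d∈ a∈ c∼d)
  ... | true  | false | true  | true  = inj₁ (edge-in-A c∈S d∈S b∈S c∈ d∈ b∈ c∼d)
  ... | false | _     | false | _     = nonadjacent-pair-in-B a∈S c∈S a∈ c∈ (a≢ (inj₁ refl)) a≁c
  ... | false | _     | true  | false = nonadjacent-pair-in-B a∈S d∈S a∈ d∈ (a≢ (inj₂ refl)) a≁d
  ... | true  | false | false | _     = nonadjacent-pair-in-B b∈S c∈S b∈ c∈ (b≢ (inj₁ refl)) b≁c
  ... | true  | false | true  | false = nonadjacent-pair-in-B b∈S d∈S b∈ d∈ (b≢ (inj₂ refl)) b≁d

module Sufficiency {n} {G : Graph n} (σ : TwoK2Partition G) where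
  open TwoK2 σ

  private
    1+m≢0 : ∀ {m} → suc m ≢ 0
    1+m≢0 ()

  -- A = C ∪ {c, d} is a clique; B = I ∪ {a, b} with cliques {v} (v ∈ I) and {a, b}.
  module FewIndependent (k : ℕ) {{_ : NonZero k}} (I+1≤k : count Ind? + 1 ≤ k) where

    A-clique : ∀ {u v} → (Cli ∪ CD) u → (Cli ∪ CD) v → u ≢ v → adj G u v ≡ true
    A-clique (inj₁ u∈C)  (inj₁ v∈C)  u≢v = C-clique u∈C v∈C u≢v
    A-clique (inj₁ u∈C)  (inj₂ v∈CD) _   = C-S-complete u∈C (CD⇒S v∈CD)
    A-clique (inj₂ u∈CD) (inj₁ v∈C)  _   = S-C-complete (CD⇒S u∈CD) v∈C
    A-clique (inj₂ u∈CD) (inj₂ v∈CD) u≢v = CD-adjacent u∈CD v∈CD u≢v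

    cliqueOf : Fin n → ℕ
    cliqueOf v = if does (Ind? v) then suc (rank Ind? v) else 0

    B-view : ∀ {v} → ¬ (Cli ∪ CD) v → Ind v ⊎ AB v
    B-view {v} v∉A with part v in eq
    ... | C = contradiction (inj₁ refl) v∉A
    ... | I = inj₁ refl
    ... | S with S-cover eq
    ...   | inj₁ v∈AB = inj₂ v∈AB
    ...   | inj₂ v∈CD = contradiction (inj₂ v∈CD) v∉A

    cliqueOf-I : ∀ {v} → Ind v → cliqueOf v ≡ suc (rank Ind? v)
    cliqueOf-I {v} v∈I with Ind? v
    ... | yes _ = refl
    ... | no v∉I = contradiction v∈I v∉I

    cliqueOf-AB : ∀ {v} → AB v → cliqueOf v ≡ 0
    cliqueOf-AB {v} v∈AB with Ind? v
    ... | yes v∈I = contradiction (AB⇒S v∈AB) (I∉S v∈I)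
    ... | no _ = refl

    cliqueOf<k : ∀ {v} → ¬ (Cli ∪ CD) v → cliqueOf v < k
    cliqueOf<k v∉A with B-view v∉A
    ... | inj₁ v∈I  = begin-strict
      cliqueOf _            ≡⟨ cliqueOf-I v∈I ⟩
      suc (rank Ind? _)     <⟨ s≤s (rank<count Ind? v∈I) ⟩
      suc (count Ind?)      ≡⟨ +-comm 1 (count Ind?) ⟩
      count Ind? + 1        ≤⟨ I+1≤k ⟩
      k                     ∎
      where open ≤-Reasoning
    ... | inj₂ v∈AB = subst (_< k) (sym (cliqueOf-AB v∈AB)) (>-nonZero⁻¹ k)

    B-spec : ∀ {u v} → ¬ (Cli ∪ CD) u → ¬ (Cli ∪ CD) v → u ≢ v → adj G u v ≡ true ⇔ cliqueOf u ≡ cliqueOf v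
    B-spec u∉A v∉A u≢v with B-view u∉A | B-view v∉A
    ... | inj₁ u∈I | inj₁ v∈I = ⇔-false (I-independent u∈I v∈I) λ eq → u≢v (rank-injective Ind? u∈I v∈I
      (suc-injective (trans (sym (cliqueOf-I u∈I)) (trans eq (cliqueOf-I v∈I)))))
    ... | inj₁ u∈I | inj₂ v∈AB = ⇔-false (I-S-anticomplete u∈I (AB⇒S v∈AB))
      λ eq → 1+m≢0 (trans (sym (cliqueOf-I u∈I)) (trans eq (cliqueOf-AB v∈AB)))
    ... | inj₂ u∈AB | inj₁ v∈I = ⇔-false (S-I-anticomplete (AB⇒S u∈AB) v∈I)
      λ eq → 1+m≢0 (trans (sym (cliqueOf-I v∈I)) (trans (sym eq) (cliqueOf-AB u∈AB)))
    ... | inj₂ u∈AB | inj₂ v∈AB = ⇔-true (AB-adjacent u∈AB v∈AB u≢v)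
      (trans (cliqueOf-AB u∈AB) (sym (cliqueOf-AB v∈AB)))

    polar : Polar k G
    polar = polar-intro {G = G} (Cli? ∪? CD?) toℕ cliqueOf
      (λ u∈A v∈A u≢v → ⇔-true (A-clique u∈A v∈A u≢v) (u≢v ∘ toℕ-injective)) cliqueOf<k B-spec

  -- A = C ∪ (I ∖ R) with parts H ∪ (I ∖ R) and singletons; B = R ∪ S with cliques {r}, {a, b}, {c, d}.
  module Hub (k : ℕ) {{_ : NonZero k}} {R H : Pred (Fin n) 0ℓ} (R? : Decidable R) (H? : Decidable H)
             (R⊆I : R ⊆ Ind) (H-unique : ∀ {x y} → H x → H y → x ≡ y)
             (I∖R-adj : ∀ {v y} → Ind v → ¬ R v → Cli y → adj G y v ≡ true ⇔ (¬ H y))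
             (R+2≤k : count R? + 2 ≤ k) where

    A : Pred (Fin n) 0ℓ
    A = Cli ∪ (Ind ∖ R)

    partOf : Fin n → ℕ
    partOf v = if does (Cli? v) then (if does (H? v) then 0 else suc (toℕ v)) else 0

    partOf-H : ∀ {v} → Cli v → H v → partOf v ≡ 0
    partOf-H {v} v∈C v∈H with Cli? v | H? v
    ... | yes _ | yes _ = refl
    ... | no v∉C | _ = contradiction v∈C v∉C
    ... | yes _ | no v∉H = contradiction v∈H v∉H

    partOf-C∖H : ∀ {v} → Cli v → ¬ H v → partOf v ≡ suc (toℕ v)
    partOf-C∖H {v} v∈C v∉H with Cli? v | H? v
    ... | yes _ | no _ = refl
    ... | no v∉C | _ = contradiction v∈C v∉C
    ... | yes _ | yes v∈H = contradiction v∈H v∉H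

    partOf-I : ∀ {v} → Ind v → partOf v ≡ 0
    partOf-I {v} v∈I with Cli? v
    ... | no _ = refl
    ... | yes v∈C = contradiction v∈C (I∉C v∈I)

    C-partOf≢ : ∀ {u v} → Cli u → Cli v → u ≢ v → partOf u ≢ partOf v
    C-partOf≢ {u} {v} u∈C v∈C u≢v = by-hub (H? u) (H? v)
      where
      by-hub : Dec (H u) → Dec (H v) → partOf u ≢ partOf v
      by-hub (yes u∈H) (yes v∈H) _  = u≢v (H-unique u∈H v∈H)
      by-hub (yes u∈H) (no v∉H)  eq = 1+m≢0 (trans (sym (partOf-C∖H v∈C v∉H)) (trans (sym eq) (partOf-H u∈C u∈H)))
      by-hub (no u∉H)  (yes v∈H) eq = 1+m≢0 (trans (sym (partOf-C∖H u∈C u∉H)) (trans eq (partOf-H v∈C v∈H)))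
      by-hub (no u∉H)  (no v∉H)  eq = u≢v (toℕ-injective (suc-injective
        (trans (sym (partOf-C∖H u∈C u∉H)) (trans eq (partOf-C∖H v∈C v∉H)))))

    C-J-spec : ∀ {y v} → Cli y → Ind v → ¬ R v → adj G y v ≡ true ⇔ partOf y ≢ partOf v
    C-J-spec {y} {v} y∈C v∈I v∉R = by-hub (H? y)
      where
      by-hub : Dec (H y) → adj G y v ≡ true ⇔ partOf y ≢ partOf v
      by-hub (yes y∈H) = mk⇔ (λ y∼v → contradiction y∈H (Equivalence.to (I∖R-adj v∈I v∉R y∈C) y∼v))
                             (λ p≢ → contradiction (trans (partOf-H y∈C y∈H) (sym (partOf-I v∈I))) p≢)
      by-hub (no y∉H) = mk⇔ (λ _ eq → 1+m≢0 (trans (sym (partOf-C∖H y∈C y∉H)) (trans eq (partOf-I v∈I))))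
                            (λ _ → Equivalence.from (I∖R-adj v∈I v∉R y∈C) y∉H)

    A-spec : ∀ {u v} → A u → A v → u ≢ v → adj G u v ≡ true ⇔ partOf u ≢ partOf v
    A-spec (inj₁ u∈C) (inj₁ v∈C) u≢v = ⇔-true (C-clique u∈C v∈C u≢v) (C-partOf≢ u∈C v∈C u≢v)
    A-spec (inj₁ u∈C) (inj₂ (v∈I , v∉R)) _ = C-J-spec u∈C v∈I v∉R
    A-spec (inj₂ (u∈I , u∉R)) (inj₁ v∈C) _ =
      mk⇔ (λ u∼v eq → Equivalence.to (C-J-spec v∈C u∈I u∉R) (adj-sym′ u∼v) (sym eq))
          (λ p≢ → adj-sym′ (Equivalence.from (C-J-spec v∈C u∈I u∉R) (p≢ ∘ sym)))
    A-spec (inj₂ (u∈I , _)) (inj₂ (v∈I , _)) _ =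
      ⇔-false (I-independent u∈I v∈I) (λ p≢ → p≢ (trans (partOf-I u∈I) (sym (partOf-I v∈I))))

    cliqueOf : Fin n → ℕ
    cliqueOf v = if does (R? v) then 2 + rank R? v else (if does (CD? v) then 1 else 0)

    B-view : ∀ {v} → ¬ A v → R v ⊎ AB v ⊎ CD v
    B-view {v} v∉A with part v in eq | R? v
    ... | C | _ = contradiction (inj₁ refl) v∉A
    ... | I | yes v∈R = inj₁ v∈R
    ... | I | no v∉R = contradiction (inj₂ (refl , v∉R)) v∉A
    ... | S | _ = inj₂ (S-cover eq)

    cliqueOf-R : ∀ {v} → R v → cliqueOf v ≡ 2 + rank R? v
    cliqueOf-R {v} v∈R with R? v
    ... | yes _ = refl
    ... | no v∉R = contradiction v∈R v∉R

    cliqueOf-AB : ∀ {v} → AB v → cliqueOf v ≡ 0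
    cliqueOf-AB {v} v∈AB with R? v | v ≟ c | v ≟ d
    ... | yes v∈R | _ | _ = contradiction (AB⇒S v∈AB) (I∉S (R⊆I v∈R))
    ... | no _ | yes v≡c | _ = contradiction refl (AB-CD-distinct v∈AB (inj₁ v≡c))
    ... | no _ | no _ | yes v≡d = contradiction refl (AB-CD-distinct v∈AB (inj₂ v≡d))
    ... | no _ | no _ | no _ = refl

    cliqueOf-CD : ∀ {v} → CD v → cliqueOf v ≡ 1
    cliqueOf-CD {v} v∈CD with R? v | v ≟ c | v ≟ d
    ... | yes v∈R | _ | _ = contradiction (CD⇒S v∈CD) (I∉S (R⊆I v∈R))
    ... | no _ | yes _ | _ = refl
    ... | no _ | no _ | yes _ = refl
    ... | no _ | no v≢c | no v≢d = contradiction v∈CD [ v≢c , v≢d ]′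

    cliqueOf<k : ∀ {v} → ¬ A v → cliqueOf v < k
    cliqueOf<k v∉A with B-view v∉A
    ... | inj₁ v∈R = begin-strict
      cliqueOf _            ≡⟨ cliqueOf-R v∈R ⟩
      2 + rank R? _         <⟨ +-monoʳ-< 2 (rank<count R? v∈R) ⟩
      2 + count R?          ≡⟨ +-comm 2 (count R?) ⟩
      count R? + 2          ≤⟨ R+2≤k ⟩
      k                     ∎
      where open ≤-Reasoning
    ... | inj₂ (inj₁ v∈AB) = subst (_< k) (sym (cliqueOf-AB v∈AB)) (>-nonZero⁻¹ k)
    ... | inj₂ (inj₂ v∈CD) = subst (_< k) (sym (cliqueOf-CD v∈CD)) (≤-trans (m≤n+m 2 (count R?)) R+2≤k)

    B-spec : ∀ {u v} → ¬ A u → ¬ A v → u ≢ v → adj G u v ≡ true ⇔ cliqueOf u ≡ cliqueOf v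
    B-spec u∉A v∉A u≢v with B-view u∉A | B-view v∉A
    ... | inj₁ u∈R | inj₁ v∈R = ⇔-false (I-independent (R⊆I u∈R) (R⊆I v∈R)) λ eq → u≢v (rank-injective R? u∈R v∈R
      (+-cancelˡ-≡ 2 _ _ (trans (sym (cliqueOf-R u∈R)) (trans eq (cliqueOf-R v∈R)))))
    ... | inj₁ u∈R | inj₂ (inj₁ v∈AB) = ⇔-false (I-S-anticomplete (R⊆I u∈R) (AB⇒S v∈AB))
      λ eq → 1+m≢0 (trans (sym (cliqueOf-R u∈R)) (trans eq (cliqueOf-AB v∈AB)))
    ... | inj₁ u∈R | inj₂ (inj₂ v∈CD) = ⇔-false (I-S-anticomplete (R⊆I u∈R) (CD⇒S v∈CD))
      λ eq → 1+m≢0 (suc-injective (trans (sym (cliqueOf-R u∈R)) (trans eq (cliqueOf-CD v∈CD))))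
    ... | inj₂ (inj₁ u∈AB) | inj₁ v∈R = ⇔-false (S-I-anticomplete (AB⇒S u∈AB) (R⊆I v∈R))
      λ eq → 1+m≢0 (trans (sym (cliqueOf-R v∈R)) (trans (sym eq) (cliqueOf-AB u∈AB)))
    ... | inj₂ (inj₂ u∈CD) | inj₁ v∈R = ⇔-false (S-I-anticomplete (CD⇒S u∈CD) (R⊆I v∈R))
      λ eq → 1+m≢0 (suc-injective (trans (sym (cliqueOf-R v∈R)) (trans (sym eq) (cliqueOf-CD u∈CD))))
    ... | inj₂ (inj₁ u∈AB) | inj₂ (inj₁ v∈AB) = ⇔-true (AB-adjacent u∈AB v∈AB u≢v)
      (trans (cliqueOf-AB u∈AB) (sym (cliqueOf-AB v∈AB)))
    ... | inj₂ (inj₂ u∈CD) | inj₂ (inj₂ v∈CD) = ⇔-true (CD-adjacent u∈CD v∈CD u≢v)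
      (trans (cliqueOf-CD u∈CD) (sym (cliqueOf-CD v∈CD)))
    ... | inj₂ (inj₁ u∈AB) | inj₂ (inj₂ v∈CD) = ⇔-false (AB-CD-nonadjacent u∈AB v∈CD)
      λ eq → 1+m≢0 (trans (sym (cliqueOf-CD v∈CD)) (trans (sym eq) (cliqueOf-AB u∈AB)))
    ... | inj₂ (inj₂ u∈CD) | inj₂ (inj₁ v∈AB) = ⇔-false (adj-sym′ (AB-CD-nonadjacent v∈AB u∈CD))
      λ eq → 1+m≢0 (trans (sym (cliqueOf-CD u∈CD)) (trans eq (cliqueOf-AB v∈AB)))

    polar : Polar k G
    polar = polar-intro {G = G} (Cli? ∪? (Ind? ∖? R?)) partOf cliqueOf A-spec cliqueOf<k B-spec

  few-incomplete⇒polar : ∀ k {{_ : NonZero k}} → count IncompleteToC? + 2 ≤ k → Polar k G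
  few-incomplete⇒polar k = Hub.polar k IncompleteToC? ∅? proj₁ (λ ()) complete
    where
    complete : ∀ {v y} → Ind v → ¬ IncompleteToC v → Cli y → adj G y v ≡ true ⇔ (¬ ∅ y)
    complete {v} {y} v∈I v∉Inc y∈C with adj G y v in y∼v
    ... | true = mk⇔ (λ _ ()) (λ _ → refl)
    ... | false = contradiction (v∈I , y , y∈C , y∼v) v∉Inc

  few-nonsole⇒polar : ∀ k {{_ : NonZero k}} {x} → Cli x → count (Ind? ∖? SoleNonNbr? x) + 2 ≤ k → Polar k G
  few-nonsole⇒polar k {x} x∈C =
    Hub.polar k (Ind? ∖? SoleNonNbr? x) (_≟ x) proj₁ (λ y≡x z≡x → trans y≡x (sym z≡x)) sole
    where
    sole : ∀ {v y} → Ind v → ¬ (Ind ∖ SoleNonNbr x) v → Cli y → adj G y v ≡ true ⇔ (y ≢ x)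
    sole {v} {y} v∈I v∉R y∈C = mk⇔ (λ { y∼v refl → true≢false (trans (sym y∼v) x≁v) })
                                    y≢x⇒adjacent
      where
      v∈P : SoleNonNbr x v
      v∈P = decidable-stable (SoleNonNbr? x v) (λ v∉P → v∉R (v∈I , v∉P))
      x≁v = proj₁ (proj₂ v∈P)
      y≢x⇒adjacent : y ≢ x → adj G y v ≡ true
      y≢x⇒adjacent y≢x with adj G y v in y∼v
      ... | true  = refl
      ... | false = contradiction (proj₂ (proj₂ v∈P) y y∈C y∼v) y≢x

  PolarCondition⇒polar : ∀ k {{_ : NonZero k}} → PolarCondition k → Polar k G
  PolarCondition⇒polar k (inj₁ I+1≤k)                   = FewIndependent.polar k I+1≤k
  PolarCondition⇒polar k (inj₂ (inj₁ Inc+2≤k))          = few-incomplete⇒polar k Inc+2≤k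
  PolarCondition⇒polar k (inj₂ (inj₂ (x , x∈C , Q+2≤k))) = few-nonsole⇒polar k x∈C Q+2≤k

module Deletion {m} {G : Graph (suc m)} (σ : TwoK2Partition G) (w : Fin (suc m))
                (w∉S : TwoK2Partition.part σ w ≢ S) where
  open TwoK2 σ
  module G-w = TwoK2 (delete-partition σ w w∉S)

  IncompleteToC-except-punchIn : ∀ {i} → IncompleteToC-except w (punchIn w i) → G-w.IncompleteToC i
  IncompleteToC-except-punchIn (i∈I , x , x∈C , x≢w , x≁i) =
    i∈I , punchOut (x≢w ∘ sym) , subst Cli (sym eq) x∈C , subst (λ z → adj G z _ ≡ false) (sym eq) x≁i
    where eq = punchIn-punchOut (x≢w ∘ sym)

  SoleNonNbr-punchIn : ∀ {y i} → G-w.SoleNonNbr y i → SoleNonNbr-except w (punchIn w y) (punchIn w i)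
  SoleNonNbr-punchIn {y} (i∈I , y≁i , only-y) = i∈I , y≁i , only-y′
    where
    only-y′ : ∀ z → Cli z → z ≢ w → adj G z _ ≡ false → z ≡ punchIn w y
    only-y′ z z∈C z≢w z≁i = trans (sym eq) (cong (punchIn w) (only-y (punchOut (z≢w ∘ sym))
                              (subst Cli (sym eq) z∈C) (subst (λ u → adj G u _ ≡ false) (sym eq) z≁i)))
      where eq = punchIn-punchOut (z≢w ∘ sym)

module MinimalObstruction {m k} {G : Graph (suc m)} (σ : TwoK2Partition G) (2≤k : 2 ≤ k)
  (not-polar : ¬ TwoK2.PolarCondition σ k)
  (deletions-polar : ∀ w (w∉S : TwoK2Partition.part σ w ≢ S) → TwoK2.PolarCondition (delete-partition σ w w∉S) k)
  where
  open TwoK2 σ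

  private
    Q? : ∀ x → Decidable (Ind ∖ SoleNonNbr x)
    Q? x = Ind? ∖? SoleNonNbr? x

    many-independent : k ≤ count Ind?
    many-independent = ≤-pred (subst (k <_) (+-comm (count Ind?) 1) (≰⇒> (not-polar ∘ inj₁)))

    many-incomplete : k < count IncompleteToC? + 2
    many-incomplete = ≰⇒> (not-polar ∘ inj₂ ∘ inj₁)

    many-nonsole : ∀ {x} → Cli x → k < count (Q? x) + 2
    many-nonsole x∈C = ≰⇒> (not-polar ∘ inj₂ ∘ inj₂ ∘ (_ ,_) ∘ (x∈C ,_))

    +2-cancel : ∀ {a b} → a + 2 ≤ k → k < b + 2 → a < b
    +2-cancel a+2≤k k<b+2 = +-cancelʳ-< 2 _ _ (<-≤-trans (s≤s a+2≤k) k<b+2)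

  module _ {x} (x∈C : Cli x) where
    private
      open Deletion σ x (C∉S x∈C)
      Witness : Set
      Witness = ∃ λ v → Ind v × adj G x v ≡ false × ∃ λ y → ∀ z → Cli z → adj G z v ≡ false → z ≡ x ⊎ z ≡ y

    C-witness-incomplete : count G-w.IncompleteToC? + 2 ≤ k → Witness
    C-witness-incomplete Inc-x+2≤k with count-<⇒∃ IncompleteToC? (IncompleteToC-except? x) except<Inc
      where
      except<Inc : count (IncompleteToC-except? x) < count IncompleteToC?
      except<Inc = +2-cancel (≤-trans (+-monoˡ-≤ 2 (count-≤-punchOut (IncompleteToC-except? x) G-w.IncompleteToC? x
                              IncompleteToC-except-punchIn (λ (v∈I , _) → C≢I x∈C v∈I))) Inc-x+2≤k) many-incomplete
    ... | v , (v∈I , z₀ , z₀∈C , z₀≁v) , not-except =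
      v , v∈I , subst (λ z → adj G z v ≡ false) (only-x z₀ z₀∈C z₀≁v) z₀≁v , x , λ z z∈C z≁v → inj₁ (only-x z z∈C z≁v)
      where
      only-x : ∀ z → Cli z → adj G z v ≡ false → z ≡ x
      only-x z z∈C z≁v = decidable-stable (z ≟ x) λ z≢x → not-except (v∈I , z , z∈C , z≢x , z≁v)

    C-witness-nonsole : ∀ {y} → G-w.Cli y → count (G-w.Ind? ∖? G-w.SoleNonNbr? y) + 2 ≤ k → Witness
    C-witness-nonsole {y} y∈C Q-x+2≤k with count-<⇒∃ (Q? y′) (Q? y′ ∖? SoleNonNbr-except? x y′) except<Q
      where
      y′ = punchIn x y
      except<Q : count (Q? y′ ∖? SoleNonNbr-except? x y′) < count (Q? y′)
      except<Q = +2-cancel (≤-trans (+-monoˡ-≤ 2 (count-≤-punchOut (Q? y′ ∖? SoleNonNbr-except? x y′)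
                   (G-w.Ind? ∖? G-w.SoleNonNbr? y) x
                   (λ ((i∈I , _) , not-except) → i∈I , not-except ∘ SoleNonNbr-punchIn)
                   (λ ((v∈I , _) , _) → C≢I x∈C v∈I))) Q-x+2≤k) (many-nonsole y∈C)
    ... | v , (v∈I , v∉P) , not-not-except = v , v∈I , x≁v , punchIn x y , cover
      where
      y′ = punchIn x y
      except : SoleNonNbr-except x y′ v
      except = decidable-stable (SoleNonNbr-except? x y′ v) λ not-except → not-not-except ((v∈I , v∉P) , not-except)
      cover : ∀ z → Cli z → adj G z v ≡ false → z ≡ x ⊎ z ≡ y′
      cover z z∈C z≁v with z ≟ x
      ... | yes z≡x = inj₁ z≡x
      ... | no z≢x = inj₂ (proj₂ (proj₂ except) z z∈C z≢x z≁v)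
      x≁v : adj G x v ≡ false
      x≁v with adj G x v in x∼v
      ... | false = refl
      ... | true = contradiction (v∈I , proj₁ (proj₂ except) , only-y′) v∉P
        where
        only-y′ : ∀ z → Cli z → adj G z v ≡ false → z ≡ y′
        only-y′ z z∈C z≁v with cover z z∈C z≁v
        ... | inj₁ refl = contradiction (trans (sym x∼v) z≁v) true≢false
        ... | inj₂ z≡y′ = z≡y′

  C-witness : ∀ {x} → Cli x →
              ∃ λ v → Ind v × adj G x v ≡ false × ∃ λ y → ∀ z → Cli z → adj G z v ≡ false → z ≡ x ⊎ z ≡ y
  C-witness {x} x∈C with deletions-polar x (C∉S x∈C)
  ... | inj₁ I-x+1≤k = contradiction (≤-trans (+-monoˡ-≤ 1 (count-≤-punchOut Ind? _ x id (C≢I x∈C))) I-x+1≤k)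
                                     (<⇒≱ (subst (k <_) (+-comm 1 (count Ind?)) (s≤s many-independent)))
  ... | inj₂ (inj₁ Inc-x+2≤k)       = C-witness-incomplete x∈C Inc-x+2≤k
  ... | inj₂ (inj₂ (_ , y∈C , Q-x+2≤k)) = C-witness-nonsole x∈C y∈C Q-x+2≤k

  count-C≤2I : count Cli? ≤ count Ind? + count Ind?
  count-C≤2I = count-≤-twice Cli? Ind? (λ x v → adj G x v ≟ᵇ false) C-witness

  module _ {w} (w∈I : Ind w) where
    private
      open Deletion σ w (I∉S w∈I)

      count-after-deletion : ∀ {P : Pred (Fin (suc m)) 0ℓ} {P′ : Pred (Fin m) 0ℓ}
                             (P? : Decidable P) (P′? : Decidable P′) → (∀ {i} → P (punchIn w i) → P′ i) →
                             k < count P? + 2 → count P′? + 2 ≤ k → P w × count P? + 1 ≤ k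
      count-after-deletion P? P′? P⇒P′ k<P+2 P′+2≤k = w∈P , (begin
        count P? + 1        ≤⟨ +-monoˡ-≤ 1 (count-≤-punchOut+1 P? P′? w P⇒P′) ⟩
        count P′? + 1 + 1   ≡⟨ +-assoc (count P′?) 1 1 ⟩
        count P′? + 2       ≤⟨ P′+2≤k ⟩
        k                   ∎)
        where
        open ≤-Reasoning
        w∈P = decidable-stable (P? w) λ w∉P → <⇒≱ k<P+2
                (≤-trans (+-monoˡ-≤ 2 (count-≤-punchOut P? P′? w P⇒P′ λ { p refl → w∉P p })) P′+2≤k)

    deleting-I-vertex : count Ind? ≤ k
               ⊎ IncompleteToC w × count IncompleteToC? + 1 ≤ k
               ⊎ ∃ λ x → Cli x × (Ind ∖ SoleNonNbr x) w × count (Q? x) + 1 ≤ k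
    deleting-I-vertex with deletions-polar w (I∉S w∈I)
    ... | inj₁ I-w+1≤k = inj₁ (≤-trans (count-≤-punchOut+1 Ind? G-w.Ind? w id) I-w+1≤k)
    ... | inj₂ (inj₁ Inc-w+2≤k) = inj₂ (inj₁ (count-after-deletion IncompleteToC? G-w.IncompleteToC?
          (IncompleteToC-except-punchIn ∘ IncompleteToC⊆IncompleteToC-except (I∉C w∈I)) many-incomplete Inc-w+2≤k))
    ... | inj₂ (inj₂ (y , y∈C , Q-w+2≤k)) = inj₂ (inj₂ (punchIn w y , y∈C , count-after-deletion (Q? (punchIn w y))
          (G-w.Ind? ∖? G-w.SoleNonNbr? y)
          (λ (i∈I , i∉P) → i∈I , i∉P ∘ SoleNonNbr-except⊆SoleNonNbr (I∉C w∈I) ∘ SoleNonNbr-punchIn)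
          (many-nonsole y∈C) Q-w+2≤k))

  I≤k⊎SoleNonNbr+1≤k : ∀ {x} → Cli x → count Ind? ≤ k ⊎ count (SoleNonNbr? x) + 1 ≤ k
  I≤k⊎SoleNonNbr+1≤k {x} x∈C with any? (SoleNonNbr? x)
  ... | no none = inj₂ (subst (λ c → c + 1 ≤ k) (sym (count-none (SoleNonNbr? x) λ v v∈P → none (v , v∈P)))
                             (≤-trans (n≤1+n 1) 2≤k))
  ... | yes (w , w∈P) with deleting-I-vertex (proj₁ w∈P)
  ...   | inj₁ I≤k = inj₁ I≤k
  ...   | inj₂ (inj₁ (_ , Inc+1≤k)) =
    inj₂ (≤-trans (+-monoˡ-≤ 1 (count-mono (SoleNonNbr? x) IncompleteToC? P⊆Inc)) Inc+1≤k)
    where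
    P⊆Inc : SoleNonNbr x ⊆ IncompleteToC
    P⊆Inc (v∈I , x≁v , _) = v∈I , x , x∈C , x≁v
  ...   | inj₂ (inj₂ (x₂ , _ , (_ , w∉P₂) , Q₂+1≤k)) =
    inj₂ (≤-trans (+-monoˡ-≤ 1 (count-mono (SoleNonNbr? x) (Q? x₂) P⊆Q₂)) Q₂+1≤k)
    where
    P⊆Q₂ : SoleNonNbr x ⊆ Ind ∖ SoleNonNbr x₂
    P⊆Q₂ (v∈I , x≁v , _) = v∈I , λ (_ , _ , only-x₂) → w∉P₂ (subst (λ z → SoleNonNbr z w) (only-x₂ x x∈C x≁v) w∈P)

  few-nonsole⇒count-I+2≤2k : ∀ {x} → Cli x → count (Q? x) + 1 ≤ k → count Ind? + 2 ≤ k + k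
  few-nonsole⇒count-I+2≤2k {x} x∈C Q+1≤k with I≤k⊎SoleNonNbr+1≤k x∈C
  ... | inj₁ I≤k = +-mono-≤ I≤k 2≤k
  ... | inj₂ P+1≤k = begin
    count Ind? + 2                                  ≤⟨ +-monoˡ-≤ 2 (count-mono Ind? (SoleNonNbr? x ∪? Q? x) split) ⟩
    count (SoleNonNbr? x ∪? Q? x) + 2               ≤⟨ +-monoˡ-≤ 2 (count-∪ (SoleNonNbr? x) (Q? x)) ⟩
    count (SoleNonNbr? x) + count (Q? x) + 2        ≡⟨ regroup (count (SoleNonNbr? x)) (count (Q? x)) ⟩
    (count (SoleNonNbr? x) + 1) + (count (Q? x) + 1) ≤⟨ +-mono-≤ P+1≤k Q+1≤k ⟩
    k + k                                           ∎
    where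
    open ≤-Reasoning
    split : Ind ⊆ SoleNonNbr x ∪ (Ind ∖ SoleNonNbr x)
    split {v} v∈I with SoleNonNbr? x v
    ... | yes v∈P = inj₁ v∈P
    ... | no v∉P = inj₂ (v∈I , v∉P)
    regroup : ∀ p q → p + q + 2 ≡ (p + 1) + (q + 1)
    regroup = solve-∀

  count-I+2≤2k : count Ind? + 2 ≤ k + k
  count-I+2≤2k with any? Ind?
  ... | no none = subst (λ c → c + 2 ≤ k + k) (sym (count-none Ind? λ v v∈I → none (v , v∈I)))
                        (≤-trans 2≤k (m≤m+n k k))
  ... | yes (w , w∈I) with deleting-I-vertex w∈I
  ...   | inj₁ I≤k = +-mono-≤ I≤k 2≤k
  ...   | inj₂ (inj₂ (x , x∈C , _ , Q+1≤k)) = few-nonsole⇒count-I+2≤2k x∈C Q+1≤k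
  ...   | inj₂ (inj₁ (_ , Inc+1≤k))
    with count-<⇒∃ Ind? IncompleteToC? (≤-trans (subst (_≤ k) (+-comm _ 1) Inc+1≤k) many-independent)
  ...     | w′ , w′∈I , w′∉Inc with deleting-I-vertex w′∈I
  ...       | inj₁ I≤k = +-mono-≤ I≤k 2≤k
  ...       | inj₂ (inj₁ (w′∈Inc , _)) = contradiction w′∈Inc w′∉Inc
  ...       | inj₂ (inj₂ (x , x∈C , _ , Q+1≤k)) = few-nonsole⇒count-I+2≤2k x∈C Q+1≤k

  order≤ : suc m ≤ count Cli? + count Ind? + 4
  order≤ = begin
    suc m                                              ≡⟨ count-U (suc m) ⟨
    count (U? {A = Fin (suc m)})                       ≤⟨ count-mono U? ((Cli? ∪? Ind?) ∪? (AB? ∪? CD?)) covered ⟩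
    count ((Cli? ∪? Ind?) ∪? (AB? ∪? CD?))             ≤⟨ count-∪ (Cli? ∪? Ind?) (AB? ∪? CD?) ⟩
    count (Cli? ∪? Ind?) + count (AB? ∪? CD?)          ≤⟨ +-mono-≤ (count-∪ Cli? Ind?) (count-∪ AB? CD?) ⟩
    count Cli? + count Ind? + (count AB? + count CD?)  ≤⟨ +-monoʳ-≤ (count Cli? + count Ind?) AB+CD≤4 ⟩
    count Cli? + count Ind? + 4                        ∎
    where
    open ≤-Reasoning
    pair≤2 : ∀ u v → count ((_≟ u) ∪? (_≟ v)) ≤ 2
    pair≤2 u v = ≤-trans (count-∪ (_≟ u) (_≟ v)) (≤-reflexive (cong₂ _+_ (count-≡ u) (count-≡ v)))
    AB+CD≤4 : count AB? + count CD? ≤ 4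
    AB+CD≤4 = +-mono-≤ (pair≤2 a b) (pair≤2 c d)
    covered : U ⊆ (Cli ∪ Ind) ∪ (AB ∪ CD)
    covered {v} _ with part v in eq
    ... | C = inj₁ (inj₁ refl)
    ... | I = inj₁ (inj₂ refl)
    ... | S = inj₂ (S-cover eq)

  order+2≤6k : suc m + 2 ≤ 6 * k
  order+2≤6k = begin
    suc m + 2                                    ≤⟨ +-monoˡ-≤ 2 order≤ ⟩
    count Cli? + count Ind? + 4 + 2              ≤⟨ +-monoˡ-≤ 2 (+-monoˡ-≤ 4 (+-monoˡ-≤ (count Ind?) count-C≤2I)) ⟩
    count Ind? + count Ind? + count Ind? + 4 + 2 ≡⟨ triple (count Ind?) ⟩
    3 * (count Ind? + 2)                         ≤⟨ *-monoʳ-≤ 3 count-I+2≤2k ⟩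
    3 * (k + k)                                  ≡⟨ sextuple k ⟩
    6 * k                                        ∎
    where
    open ≤-Reasoning
    triple : ∀ i → i + i + i + 4 + 2 ≡ 3 * (i + 2)
    triple = solve-∀
    sextuple : ∀ k → 3 * (k + k) ≡ 6 * k
    sextuple = solve-∀

1+n≤2^n : ∀ n → suc n ≤ 2 ^ n
1+n≤2^n zero    = s≤s z≤n
1+n≤2^n (suc n) = begin
  suc (suc n)       ≡⟨ +-comm 1 (suc n) ⟩
  suc n + 1         ≤⟨ +-mono-≤ (1+n≤2^n n) (m^n>0 2 n) ⟩
  2 ^ n + 2 ^ n     ≡⟨ cong (2 ^ n +_) (+-identityʳ (2 ^ n)) ⟨
  2 ^ suc n         ∎
  where open ≤-Reasoning

2*n≤2^n : ∀ n → 2 * n ≤ 2 ^ n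
2*n≤2^n zero    = z≤n
2*n≤2^n (suc n) = *-monoʳ-≤ 2 (1+n≤2^n n)

order-arith : ∀ j N → N + 2 ≤ 6 * suc j → N ≤ 2 + 2 * suc j + 2 ^ (2 * suc j ∸ 1)
order-arith j N N+2≤6k = begin
  N                                     ≤⟨ +-cancelʳ-≤ 2 N _ N+2≤bound+2 ⟩
  2 + 2 * suc j + 2 * suc (2 * j)       ≤⟨ +-monoʳ-≤ (2 + 2 * suc j) (2*n≤2^n (suc (2 * j))) ⟩
  2 + 2 * suc j + 2 ^ suc (2 * j)       ≡⟨ cong (λ e → 2 + 2 * suc j + 2 ^ e) (+-suc j (j + 0)) ⟨
  2 + 2 * suc j + 2 ^ (2 * suc j ∸ 1)   ∎
  where
  open ≤-Reasoning
  regroup : ∀ j → 6 * suc j + 2 ≡ 2 + 2 * suc j + 2 * suc (2 * j) + 2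
  regroup = solve-∀
  N+2≤bound+2 : N + 2 ≤ 2 + 2 * suc j + 2 * suc (2 * j) + 2
  N+2≤bound+2 = ≤-trans N+2≤6k (≤-trans (m≤m+n _ 2) (≤-reflexive (regroup j)))

order-bound : ∀ j {m} {G : Graph (suc m)} → TwoK2Split G → MinObstruction (2 + j) G → suc m + 2 ≤ 6 * (2 + j)
order-bound j {G = G} split (not-polar , deletions-polar) with twoK2Split-cases {k = suc j} {G} split
... | inj₁ polar = contradiction polar not-polar
... | inj₂ σ = MinimalObstruction.order+2≤6k σ (s≤s (s≤s z≤n))
  (not-polar ∘ Sufficiency.PolarCondition⇒polar σ (2 + j))
  (λ w w∉S → Necessity.polar⇒PolarCondition (delete-partition σ w w∉S) (deletions-polar w))

mainTheorem17 : (k : ℕ) → 2 ≤ k →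
    ((m : ℕ) (G : Graph (suc m)) → TwoK2Split G → MinObstruction k G →
        suc m ≤ 2 + 2 * k + 2 ^ (2 * k ∸ 1))
    × Σ ℕ (λ N → (m : ℕ) (G : Graph (suc m)) → TwoK2Split G → MinObstruction k G →
        suc m ≤ N)
mainTheorem17 (suc (suc j)) (s≤s (s≤s z≤n)) = bound , 2 + 2 * suc (suc j) + 2 ^ (2 * suc (suc j) ∸ 1) , bound
  where
  bound : (m : ℕ) (G : Graph (suc m)) → TwoK2Split G → MinObstruction (suc (suc j)) G →
          suc m ≤ 2 + 2 * suc (suc j) + 2 ^ (2 * suc (suc j) ∸ 1)
  bound m G split obstruction = order-arith (suc j) (suc m) (order-bound j {G = G} split obstruction)
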